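{- Let $h \geq 3$ be an integer and let $A = \{a_1, \ldots, a_h\}$ be a set of odd positive integers with $a_1 < \cdots < a_h$. Then \[|h^{\wedge}_{\pm}A| \geq h^2 - 1.\] This lower bound is best possible: for every $h \geq 3$ there is such a set $A$ (e.g. $A = \{1, 3, \ldots, 2h-1\}$) with $|h^{\wedge}_{\pm}A| = h^2 - 1$.
   Context: For a finite set $A = \{a_1, \ldots, a_k\}$ of integers (with distinct $a_i$) and a positive integer $h$, the restricted $h$-fold signed sumset is \[h^{\wedge}_{\pm}A = \left\{ \sum_{i=1}^{k} \lambda_i a_i : \lambda_i \in \{ -1,0,1\}, \ \sum_{i=1}^{k} |\lambda_i| = h \right\}.\] -}

module Defs where

open import Data.Nat as ℕ using (ℕ; zero; suc)
open import Data.Integer as ℤ using (ℤ; +_; -_)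
open import Data.Integer.Properties using () renaming (_≟_ to _≟ℤ_)
open import Data.Fin using (Fin)
open import Data.Vec as Vec using (Vec; []; _∷_; lookup)
open import Data.List as List using (List; []; _∷_; _++_; concatMap; filter; deduplicate; length)
open import Data.Product using (∃)
open import Relation.Binary.PropositionalEquality using (_≡_)
open import Data.Nat.Properties using () renaming (_≟_ to _≟ℕ_)

Odd : ℕ → Set
Odd n = ∃ λ k → n ≡ suc (2 ℕ.* k)

coeffs : List ℤ
coeffs = ℤ.-1ℤ ∷ ℤ.0ℤ ∷ ℤ.1ℤ ∷ []

allCoeffVecs : (k : ℕ) → List (Vec ℤ k)
allCoeffVecs zero = [] ∷ []
allCoeffVecs (suc k) = concatMap (λ c → List.map (c ∷_) (allCoeffVecs k)) coeffs

weight : ∀ {k} → Vec ℤ k → ℕ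
weight [] = 0
weight (c ∷ cs) = ℤ.∣ c ∣ ℕ.+ weight cs

dot : ∀ {k} → Vec ℤ k → Vec ℤ k → ℤ
dot [] [] = ℤ.0ℤ
dot (c ∷ cs) (x ∷ xs) = c ℤ.* x ℤ.+ dot cs xs

signedSumList : ℕ → ∀ {k} → Vec ℤ k → List ℤ
signedSumList h {k} A =
  List.map (λ λs → dot λs A) (filter (λ λs → weight λs ≟ℕ h) (allCoeffVecs k))

restrictedSignedSumsetSize : ℕ → ∀ {k} → Vec ℤ k → ℕ
restrictedSignedSumsetSize h A = length (deduplicate _≟ℤ_ (signedSumList h A))

StrictlyIncreasing : ∀ {k} → Vec ℕ k → Set
StrictlyIncreasing {k} a = ∀ (i j : Fin k) → Data.Fin._<_ i j → lookup a i ℕ.< lookup a j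
  where import Data.Fin

OddPositive : ∀ {k} → Vec ℕ k → Set
OddPositive {k} a = ∀ (i : Fin k) → 0 ℕ.< lookup a i × Odd (lookup a i)
  where open import Data.Product using (_×_)

toℤ : ∀ {k} → Vec ℕ k → Vec ℤ k
toℤ = Vec.map +_

-- When all h elements of A carry a sign ±1, the signed sum is S − 2u, where S is the sum of A
-- and u the sum of the elements with sign −1; so |h^∧_± A| is the number of distinct subset sums
-- of A. These are counted by adding the elements in increasing order. Let B be the set of the n
-- smallest elements, p < q its two smallest and m its largest, S its sum, and x the next element.
-- Then x + (S − r) is a subset sum of B ∪ {x} but not of B whenever r is a subset sum of B which is
-- not x plus a subset sum of B. By size and parity this holds for the 2n values r = 0, the elements
-- of B, and p + y for y ∈ B ∖ {p}, and, once n ≥ 3, also for r = m + q (if x + p ≠ m + q) or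
-- r = m + q + p (if x + p = m + q). Starting from the 4 subset sums of {p, q} this yields
-- 4 + 4 = 3² − 1 and then (n + 1)² − 1 = (n² − 1) + (2n + 1) distinct subset sums. For
-- A = {1, 3, …, 2h − 1} every subset sum lies in {0, …, h²} and differs from 2 and, by
-- complementation, from h² − 2.

module Submission where

open import Defs
open import Data.Nat using (ℕ; _≤_; _*_; _∸_)
open import Data.Vec using (Vec)
open import Data.Product using (_×_; ∃)
open import Relation.Binary.PropositionalEquality using (_≡_)

open import Data.Empty using (⊥; ⊥-elim)
open import Data.Sum using (_⊎_; inj₁; inj₂)
open import Data.Product using (_,_; proj₁; proj₂)
open import Function using (_∘_; flip)
open import Relation.Nullary using (¬_; yes; no)
open import Relation.Binary.Definitions using (tri<; tri≈; tri>)
open import Relation.Binary.PropositionalEquality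
  using (_≢_; refl; sym; trans; cong; cong₂; subst; subst₂; module ≡-Reasoning)
open import Data.Nat using (zero; suc; _+_; _<_; _>_; z≤n; s≤s; z<s; s<s)
open import Data.Nat.Properties
open import Data.Nat.ListAction using (sum)
open import Data.Nat.Tactic.RingSolver using (solve-∀)
open import Data.Integer as ℤ using (ℤ)
import Data.Integer.Properties as ℤ
import Data.Integer.Tactic.RingSolver as ℤ-Solver
open import Data.Fin using (Fin; zero; suc; toℕ)
open import Data.Vec using ([]; _∷_; lookup; toList)
open import Data.Vec.Properties using (length-toList)
import Data.Vec.Relation.Unary.All.Properties as VecAll
open import Data.List using (List; []; _∷_; _++_; _∷ʳ_; map; length; reverse; upTo; deduplicate)
open import Data.List.Properties
  using (length-++; length-map; length-reverse; unfold-reverse; length-upTo; length-removeAt′)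
open import Data.List.Relation.Unary.All as All using (All; []; _∷_)
import Data.List.Relation.Unary.All.Properties as All
open import Data.List.Relation.Unary.Any as Any using (here; there; _─_)
import Data.List.Relation.Unary.Any.Properties as Any
open import Data.List.Relation.Unary.AllPairs as AllPairs using (AllPairs; []; _∷_)
import Data.List.Relation.Unary.AllPairs.Properties as AllPairs
open import Data.List.Relation.Unary.Unique.Propositional using (Unique)
import Data.List.Relation.Unary.Unique.Propositional.Properties as Unique
open import Data.List.Relation.Unary.Unique.DecPropositional.Properties ℤ._≟_ using (deduplicate-!)
open import Data.List.Relation.Binary.Disjoint.Propositional using (Disjoint)
open import Data.List.Relation.Binary.Subset.Propositional using (_⊆_)
open import Data.List.Relation.Binary.Permutation.Propositional as ↭ using (_↭_)
open import Data.List.Relation.Binary.Permutation.Propositional.Properties using (↭-reverse)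
open import Data.List.Membership.Propositional using (_∈_)
open import Data.List.Membership.Propositional.Properties
  using ( ∈-++⁺ˡ; ∈-++⁺ʳ; ∈-map⁺; ∈-map⁻; ∈-upTo⁺; ∈-concatMap⁺; ∈-concatMap⁻
        ; ∈-map∘filter⁺; ∈-map∘filter⁻; ∈-deduplicate⁺; ∈-deduplicate⁻)

Even : ℕ → Set
Even n = ∃ λ k → n ≡ 2 * k

odd-positive : ∀ {n} → Odd n → 0 < n
odd-positive (_ , refl) = z<s

odd+odd-even : ∀ {m n} → Odd m → Odd n → Even (m + n)
odd+odd-even (a , refl) (b , refl) = suc (a + b) , identity a b
  where
  identity : ∀ a b → suc (2 * a) + suc (2 * b) ≡ 2 * suc (a + b)
  identity = solve-∀

even+odd-odd : ∀ {m n} → Even m → Odd n → Odd (m + n)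
even+odd-odd (a , refl) (b , refl) = a + b , identity a b
  where
  identity : ∀ a b → 2 * a + suc (2 * b) ≡ suc (2 * (a + b))
  identity = solve-∀

even≢odd′ : ∀ {m n} → Even m → Odd n → m ≢ n
even≢odd′ (a , refl) (b , refl) = even≢odd a b

module _ {A : Set} where

  ∈-─ : ∀ {x z : A} {ys} (x∈ys : x ∈ ys) → z ∈ ys → z ≢ x → z ∈ (ys ─ x∈ys)
  ∈-─ (here refl)  (here refl)  z≢x = ⊥-elim (z≢x refl)
  ∈-─ (here refl)  (there z∈ys) _   = z∈ys
  ∈-─ (there x∈ys) (here refl)  _   = here refl
  ∈-─ (there x∈ys) (there z∈ys) z≢x = there (∈-─ x∈ys z∈ys z≢x)

  Unique-⊆⇒length-≤ : ∀ {xs ys : List A} → Unique xs → xs ⊆ ys → length xs ≤ length ys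
  Unique-⊆⇒length-≤ {[]}     _          _    = z≤n
  Unique-⊆⇒length-≤ {x ∷ xs} {ys} (x∉xs ∷ u) xs⊆ys =
    subst (suc (length xs) ≤_) (sym (length-removeAt′ ys (Any.index x∈ys)))
      (s≤s (Unique-⊆⇒length-≤ u xs⊆ys─x))
    where
    x∈ys = xs⊆ys (here refl)
    xs⊆ys─x : xs ⊆ (ys ─ x∈ys)
    xs⊆ys─x z∈xs = ∈-─ x∈ys (xs⊆ys (there z∈xs)) (λ { refl → All.lookup x∉xs z∈xs refl })

  Unique-map⁺-on : ∀ {B : Set} {P : A → Set} {f : A → B} {xs} →
                   (∀ {a b} → P a → P b → f a ≡ f b → a ≡ b) →
                   All P xs → Unique xs → Unique (map f xs)
  Unique-map⁺-on f-inj []         []       = []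
  Unique-map⁺-on f-inj (pa ∷ pas) (a∉ ∷ u) =
    All.map⁺ (All.zipWith (λ { (pb , a≢b) fa≡fb → a≢b (f-inj pa pb fa≡fb) }) (pas , a∉))
    ∷ Unique-map⁺-on f-inj pas u

  All-reverse⁺ : ∀ {P : A → Set} {xs} → All P xs → All P (reverse xs)
  All-reverse⁺ pxs = All.tabulate (λ x∈ → All.lookup pxs (Any.reverse⁻ x∈))

  AllPairs-reverse⁺ : ∀ {R : A → A → Set} {xs} → AllPairs R xs → AllPairs (flip R) (reverse xs)
  AllPairs-reverse⁺ [] = []
  AllPairs-reverse⁺ {xs = x ∷ xs} (rx ∷ rxs) =
    subst (AllPairs _) (sym (unfold-reverse x xs))
      (AllPairs.++⁺ (AllPairs-reverse⁺ rxs) ([] ∷ []) (All.map (_∷ []) (All-reverse⁺ rx)))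

  Disjoint-All : ∀ {P Q : A → Set} {xs ys} →
                 All P xs → All Q ys → (∀ {v} → P v → Q v → ⊥) → Disjoint xs ys
  Disjoint-All pxs qys P⇒¬Q (v∈xs , v∈ys) = P⇒¬Q (All.lookup pxs v∈xs) (All.lookup qys v∈ys)

decreasing⇒Unique : ∀ {xs} → AllPairs _>_ xs → Unique xs
decreasing⇒Unique = AllPairs.map >⇒≢

-- Subset sums

data SubsetSum : List ℕ → ℕ → Set where
  empty : SubsetSum [] 0
  skip  : ∀ {x xs u} → SubsetSum xs u → SubsetSum (x ∷ xs) u
  pick  : ∀ {x xs u} → SubsetSum xs u → SubsetSum (x ∷ xs) (x + u)

subsetSum-zero : ∀ xs → SubsetSum xs 0
subsetSum-zero []       = empty
subsetSum-zero (x ∷ xs) = skip (subsetSum-zero xs)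

subsetSum-∈ : ∀ {x xs} → x ∈ xs → SubsetSum xs x
subsetSum-∈ {x} {_ ∷ xs} (here refl) =
  subst (SubsetSum (x ∷ xs)) (+-identityʳ x) (pick (subsetSum-zero xs))
subsetSum-∈ (there x∈xs) = skip (subsetSum-∈ x∈xs)

subsetSum-++⁺ˡ : ∀ {xs u} ys → SubsetSum xs u → SubsetSum (xs ++ ys) u
subsetSum-++⁺ˡ ys empty    = subsetSum-zero ys
subsetSum-++⁺ˡ ys (skip s) = skip (subsetSum-++⁺ˡ ys s)
subsetSum-++⁺ˡ ys (pick s) = pick (subsetSum-++⁺ˡ ys s)

subsetSum-++ : ∀ {xs ys u v} → SubsetSum xs u → SubsetSum ys v → SubsetSum (xs ++ ys) (u + v)
subsetSum-++ empty    t = t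
subsetSum-++ (skip s) t = skip (subsetSum-++ s t)
subsetSum-++ {x ∷ xs} {ys} (pick {u = u} s) t =
  subst (SubsetSum (x ∷ xs ++ ys)) (sym (+-assoc x u _)) (pick (subsetSum-++ s t))

subsetSum-≤ : ∀ {xs u} → SubsetSum xs u → u ≤ sum xs
subsetSum-≤ empty        = z≤n
subsetSum-≤ (skip {x} s) = ≤-trans (subsetSum-≤ s) (m≤n+m _ x)
subsetSum-≤ (pick {x} s) = +-monoʳ-≤ x (subsetSum-≤ s)

subsetSum-complement : ∀ {xs u} → SubsetSum xs u → SubsetSum xs (sum xs ∸ u)
subsetSum-complement empty = empty
subsetSum-complement {x ∷ xs} (skip s) =
  subst (SubsetSum (x ∷ xs)) (sym (+-∸-assoc x (subsetSum-≤ s))) (pick (subsetSum-complement s))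
subsetSum-complement {x ∷ xs} (pick {u = u} s) =
  subst (SubsetSum (x ∷ xs)) (sym ([m+n]∸[m+o]≡n∸o x (sum xs) u)) (skip (subsetSum-complement s))

subsetSum-↭ : ∀ {xs ys u} → xs ↭ ys → SubsetSum xs u → SubsetSum ys u
subsetSum-↭ ↭.refl         s               = s
subsetSum-↭ (↭.prep x p)   (skip s)        = skip (subsetSum-↭ p s)
subsetSum-↭ (↭.prep x p)   (pick s)        = pick (subsetSum-↭ p s)
subsetSum-↭ (↭.swap x y p) (skip (skip s)) = skip (skip (subsetSum-↭ p s))
subsetSum-↭ (↭.swap x y p) (skip (pick s)) = pick (skip (subsetSum-↭ p s))
subsetSum-↭ (↭.swap x y p) (pick (skip s)) = skip (pick (subsetSum-↭ p s))
subsetSum-↭ {ys = _ ∷ _ ∷ ys} (↭.swap x y p) (pick (pick {u = u} s)) =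
  subst (SubsetSum (y ∷ x ∷ ys)) (exchange x y u) (pick (pick (subsetSum-↭ p s)))
  where
  exchange : ∀ x y u → y + (x + u) ≡ x + (y + u)
  exchange = solve-∀
subsetSum-↭ (↭.trans p p′) s = subsetSum-↭ p′ (subsetSum-↭ p s)

complement-shift-sym : ∀ {x r v S} → r ≤ S → v ≤ S → v ≡ x + (S ∸ r) → r ≡ x + (S ∸ v)
complement-shift-sym {x} {r} {v} {S} r≤S v≤S refl = +-cancelʳ-≡ (S ∸ r) r (x + (S ∸ v)) (begin
  r + (S ∸ r)            ≡⟨ m+[n∸m]≡n r≤S ⟩
  S                      ≡⟨ m+[n∸m]≡n v≤S ⟨
  v + (S ∸ v)            ≡⟨ +-assoc x (S ∸ r) (S ∸ v) ⟩
  x + ((S ∸ r) + (S ∸ v)) ≡⟨ cong (x +_) (+-comm (S ∸ r) (S ∸ v)) ⟩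
  x + ((S ∸ v) + (S ∸ r)) ≡⟨ +-assoc x (S ∸ v) (S ∸ r) ⟨
  x + (S ∸ v) + (S ∸ r)  ∎)
  where open ≡-Reasoning

shiftedComplement : ℕ → List ℕ → ℕ → ℕ
shiftedComplement x xs r = x + (sum xs ∸ r)

NotShiftedSum : ℕ → List ℕ → ℕ → Set
NotShiftedSum x xs r = ∀ {u} → SubsetSum xs u → r ≢ x + u

-- If v = x + (S − r) were a subset sum of xs, then so would be S − v, and r = x + (S − v).
extend-sums : ∀ x xs {L R} → All (SubsetSum xs) L → Unique L →
              All (SubsetSum xs) R → Unique R → All (NotShiftedSum x xs) R →
              All (SubsetSum (x ∷ xs)) (L ++ map (shiftedComplement x xs) R) ×
              Unique (L ++ map (shiftedComplement x xs) R)
extend-sums x xs sums-L unique-L sums-R unique-R notShifted-R =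
  All.++⁺ (All.map skip sums-L) (All.map⁺ (All.map (pick ∘ subsetSum-complement) sums-R)) ,
  Unique.++⁺ unique-L
    (Unique-map⁺-on (λ r≤S r′≤S eq → ∸-cancelˡ-≡ r≤S r′≤S (+-cancelˡ-≡ x _ _ eq))
                    (All.map subsetSum-≤ sums-R) unique-R)
    (Disjoint-All {Q = ¬_ ∘ SubsetSum xs} sums-L
                  (All.map⁺ (All.zipWith new (sums-R , notShifted-R))) (λ s ¬s → ¬s s))
  where
  new : ∀ {r} → SubsetSum xs r × NotShiftedSum x xs r → ¬ SubsetSum xs (shiftedComplement x xs r)
  new (s , notShifted) s′ =
    notShifted (subsetSum-complement s′) (complement-shift-sym (subsetSum-≤ s) (subsetSum-≤ s′) refl)

-- A set with smallest elements p < q is listed decreasingly as B ys, so that it grows by a new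
-- maximum at the head.
module OddSubsetSums (p q : ℕ) (odd-p : Odd p) (odd-q : Odd q) (p<q : p < q) where

  B : List ℕ → List ℕ
  B ys = ys ∷ʳ q ∷ʳ p

  record Admissible (ys : List ℕ) : Set where
    field
      decreasing : AllPairs _>_ (ys ∷ʳ q)
      odd        : All Odd ys
  open Admissible

  admissible-tail : ∀ {x ys} → Admissible (x ∷ ys) → Admissible ys
  admissible-tail adm = record { decreasing = AllPairs.tail (decreasing adm) ; odd = All.tail (odd adm) }

  above-q : ∀ {ys} → AllPairs _>_ (ys ∷ʳ q) → All (q <_) ys
  above-q {[]}     _            = []
  above-q {y ∷ ys} (y>ys ∷ dec) = proj₂ (All.∷ʳ⁻ y>ys) ∷ above-q dec

  below-head : ∀ {x ys} → AllPairs _>_ (x ∷ ys ∷ʳ q) → All (_< x) (B ys)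
  below-head (x>ys ∷ _) = All.∷ʳ⁺ x>ys (<-trans p<q (proj₂ (All.∷ʳ⁻ x>ys)))

  B-decreasing : ∀ {ys} → Admissible ys → AllPairs _>_ (B ys)
  B-decreasing adm = AllPairs.++⁺ (decreasing adm) ([] ∷ [])
    (All.map (_∷ []) (All.∷ʳ⁺ (All.map (<-trans p<q) (above-q (decreasing adm))) p<q))

  B-odd : ∀ {ys} → Admissible ys → All Odd (B ys)
  B-odd adm = All.∷ʳ⁺ (All.∷ʳ⁺ (odd adm) odd-q) odd-p

  -- A subset sum of B ys below q + p is 0, p or a single element, which is odd.
  data Shape : ℕ → Set where
    nothing : Shape 0
    only-p  : Shape p
    odd≥q   : ∀ {u} → Odd u → q ≤ u → Shape u
    ≥q+p    : ∀ {u} → q + p ≤ u → Shape u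

  shape : ∀ {ys u} → All (q <_) ys → All Odd ys → SubsetSum (B ys) u → Shape u
  shape [] [] (skip (skip empty)) = nothing
  shape [] [] (skip (pick empty)) = subst Shape (sym (+-identityʳ p)) only-p
  shape [] [] (pick (skip empty)) = odd≥q (subst Odd (sym (+-identityʳ q)) odd-q) (m≤m+n q 0)
  shape [] [] (pick (pick empty)) = ≥q+p (≤-reflexive (cong (q +_) (sym (+-identityʳ p))))
  shape (_ ∷ q<ys) (_ ∷ odd-ys) (skip s) = shape q<ys odd-ys s
  shape {y ∷ _} (q<y ∷ q<ys) (odd-y ∷ odd-ys) (pick s) with shape q<ys odd-ys s
  ... | nothing     = odd≥q (subst Odd (sym (+-identityʳ y)) odd-y) (≤-trans (<⇒≤ q<y) (m≤m+n y 0))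
  ... | only-p      = ≥q+p (+-monoˡ-≤ p (<⇒≤ q<y))
  ... | odd≥q _ q≤u = ≥q+p (+-mono-≤ (<⇒≤ q<y) (≤-trans (<⇒≤ p<q) q≤u))
  ... | ≥q+p q+p≤u  = ≥q+p (≤-trans q+p≤u (m≤n+m _ y))

  basicSeeds : List ℕ → List ℕ
  basicSeeds ys = 0 ∷ B ys ++ map (_+ p) (ys ∷ʳ q)

  All-basicSeeds : ∀ {P : ℕ → Set} {ys} →
                   P 0 → All P (B ys) → All (P ∘ (_+ p)) (ys ∷ʳ q) → All P (basicSeeds ys)
  All-basicSeeds P0 PB Pshifted = P0 ∷ All.++⁺ PB (All.map⁺ Pshifted)

  extra : ℕ → ℕ → ℕ
  extra x m with x + p ≟ m + q
  ... | yes _ = m + q + p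
  ... | no  _ = m + q

  seeds : ℕ → List ℕ → List ℕ
  seeds x []       = basicSeeds []
  seeds x (m ∷ ys) = extra x m ∷ basicSeeds (m ∷ ys)

  distinctSums : List ℕ → List ℕ
  distinctSums []       = basicSeeds []
  distinctSums (x ∷ ys) = distinctSums ys ++ map (shiftedComplement x (B ys)) (seeds x ys)

  basicSeeds-sums : ∀ ys → All (SubsetSum (B ys)) (basicSeeds ys)
  basicSeeds-sums ys = All-basicSeeds (subsetSum-zero (B ys)) (All.tabulate subsetSum-∈)
    (All.tabulate (λ y∈ → subsetSum-++ (subsetSum-∈ y∈) (subsetSum-∈ (here refl))))

  m+q-sum : ∀ m ys → SubsetSum (m ∷ ys ∷ʳ q) (m + q)
  m+q-sum m ys = pick (subsetSum-∈ (∈-++⁺ʳ ys (here refl)))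

  extra-sum : ∀ x m ys → SubsetSum (B (m ∷ ys)) (extra x m)
  extra-sum x m ys with x + p ≟ m + q
  ... | yes _ = subsetSum-++ (m+q-sum m ys) (subsetSum-∈ (here refl))
  ... | no  _ = subsetSum-++⁺ˡ (p ∷ []) (m+q-sum m ys)

  seeds-sums : ∀ x ys → All (SubsetSum (B ys)) (seeds x ys)
  seeds-sums x []       = basicSeeds-sums []
  seeds-sums x (m ∷ ys) = extra-sum x m ys ∷ basicSeeds-sums (m ∷ ys)

  shifted-even : ∀ {ys} → Admissible ys → All (Even ∘ (_+ p)) (ys ∷ʳ q)
  shifted-even adm = All.map (λ odd-y → odd+odd-even odd-y odd-p) (All.∷ʳ⁺ (odd adm) odd-q)

  basicSeeds-unique : ∀ {ys} → Admissible ys → Unique (basicSeeds ys)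
  basicSeeds-unique {ys} adm =
    All.map <⇒≢ (All.++⁺ (All.map odd-positive (B-odd adm))
                         (All.map⁺ (All.tabulate (λ {y} _ → <-≤-trans (odd-positive odd-p) (m≤n+m p y)))))
    ∷ Unique.++⁺ (decreasing⇒Unique (B-decreasing adm))
        (Unique.map⁺ (λ {y} {y′} → +-cancelʳ-≡ p y y′) (decreasing⇒Unique (decreasing adm)))
        (Disjoint-All (B-odd adm) (All.map⁺ (shifted-even adm))
                      (λ odd-v even-v → even≢odd′ even-v odd-v refl))

  extra∉basicSeeds : ∀ {x m ys} → Admissible (m ∷ ys) → All (extra x m ≢_) (basicSeeds (m ∷ ys))
  extra∉basicSeeds {x} {m} {ys} adm with x + p ≟ m + q
  ... | yes _ = All-basicSeeds {ys = m ∷ ys} (>⇒≢ m+q+p>0)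
                  (All.map (λ y≤m → >⇒≢ (≤-<-trans y≤m m<m+q+p)) ≤m-B)
                  (All.map (λ even-y+p e → even≢odd′ even-y+p odd-m+q+p (sym e)) (shifted-even adm))
    where
    m+q+p>0 : 0 < m + q + p
    m+q+p>0 = <-≤-trans (odd-positive odd-p) (m≤n+m p (m + q))
    m<m+q+p : m < m + q + p
    m<m+q+p = <-≤-trans (m<m+n m (odd-positive odd-q)) (m≤m+n (m + q) p)
    ≤m-B : All (_≤ m) (B (m ∷ ys))
    ≤m-B = ≤-refl ∷ All.map <⇒≤ (below-head (decreasing adm))
    odd-m+q+p : Odd (m + q + p)
    odd-m+q+p = even+odd-odd (odd+odd-even (All.head (odd adm)) odd-q) odd-p
  ... | no _ = All-basicSeeds {ys = m ∷ ys} (>⇒≢ (<-≤-trans (odd-positive odd-q) (m≤n+m q m)))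
                 (All.map (even≢odd′ (odd+odd-even (All.head (odd adm)) odd-q)) (B-odd adm))
                 (All.map (λ y≤m → >⇒≢ (+-mono-≤-< y≤m p<q)) ≤m-shifted)
    where
    ≤m-shifted : All (_≤ m) (m ∷ ys ∷ʳ q)
    ≤m-shifted = ≤-refl ∷ All.map <⇒≤ (AllPairs.head (decreasing adm))

  seeds-unique : ∀ {x ys} → Admissible (x ∷ ys) → Unique (seeds x ys)
  seeds-unique {x} {[]}     adm = basicSeeds-unique (admissible-tail adm)
  seeds-unique {x} {m ∷ ys} adm =
    extra∉basicSeeds {x} (admissible-tail adm) ∷ basicSeeds-unique (admissible-tail adm)

  basicSeeds-notShifted : ∀ {x ys} → Admissible (x ∷ ys) →
                          All (NotShiftedSum x (B ys)) (basicSeeds ys)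
  basicSeeds-notShifted {x} {ys} adm = All-basicSeeds {ys = ys}
    (λ {u} _ → <⇒≢ (<-≤-trans (odd-positive odd-x) (m≤m+n x u)))
    (All.map (λ y<x {u} _ → <⇒≢ (<-≤-trans y<x (m≤m+n x u))) (below-head (decreasing adm)))
    (All.zipWith avoids (AllPairs.head (decreasing adm) , All.∷ʳ⁺ (odd adm′) odd-q))
    where
    adm′ = admissible-tail adm
    odd-x = All.head (odd adm)
    avoids : ∀ {y} → y < x × Odd y → NotShiftedSum x (B ys) (y + p)
    avoids (y<x , odd-y) s with shape (above-q (decreasing adm′)) (odd adm′) s
    ... | nothing     = λ e → even≢odd′ (odd+odd-even odd-y odd-p) odd-x (trans e (+-identityʳ x))
    ... | only-p      = λ e → <⇒≢ y<x (+-cancelʳ-≡ p _ _ e)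
    ... | odd≥q _ q≤u = <⇒≢ (+-mono-< y<x (<-≤-trans p<q q≤u))
    ... | ≥q+p q+p≤u  = <⇒≢ (+-mono-< y<x (<-≤-trans p<q (≤-trans (m≤m+n q p) q+p≤u)))

  extra-notShifted : ∀ {x m ys} → Admissible (x ∷ m ∷ ys) →
                     NotShiftedSum x (B (m ∷ ys)) (extra x m)
  extra-notShifted {x} {m} {ys} adm s = avoids (shape (above-q (decreasing adm′)) (odd adm′) s)
    where
    adm′ = admissible-tail adm
    odd-x = All.head (odd adm)
    odd-m = All.head (odd adm′)
    m<x : m < x
    m<x = All.head (AllPairs.head (decreasing adm))
    p>0 = odd-positive odd-p
    open ≤-Reasoning
    avoids : ∀ {u} → Shape u → extra x m ≢ x + u
    avoids sh with x + p ≟ m + q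
    avoids nothing | yes x+p≡m+q = λ e → <-irrefl refl (begin-strict
      m + q      <⟨ m<m+n (m + q) p>0 ⟩
      m + q + p  ≡⟨ trans e (+-identityʳ x) ⟩
      x          ≤⟨ m≤m+n x p ⟩
      x + p      ≡⟨ x+p≡m+q ⟩
      m + q      ∎)
    avoids only-p | yes x+p≡m+q = λ e → <-irrefl refl (begin-strict
      x          <⟨ m<m+n x p>0 ⟩
      x + p      ≡⟨ x+p≡m+q ⟩
      m + q      ≡⟨ +-cancelʳ-≡ p _ _ e ⟩
      x          ∎)
    avoids (odd≥q odd-u _) | yes _ = λ e →
      even≢odd′ (odd+odd-even odd-x odd-u) (even+odd-odd (odd+odd-even odd-m odd-q) odd-p) (sym e)
    avoids (≥q+p {u} q+p≤u) | yes _ =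
      <⇒≢ (subst (_< x + u) (sym (+-assoc m q p)) (+-mono-<-≤ m<x q+p≤u))
    avoids nothing | no _ = λ e → even≢odd′ (odd+odd-even odd-m odd-q) odd-x (trans e (+-identityʳ x))
    avoids only-p | no x+p≢m+q = λ e → x+p≢m+q (sym e)
    avoids (odd≥q _ q≤u) | no _ = <⇒≢ (+-mono-<-≤ m<x q≤u)
    avoids (≥q+p q+p≤u) | no _ = <⇒≢ (+-mono-<-≤ m<x (≤-trans (m≤m+n q p) q+p≤u))

  seeds-notShifted : ∀ {x ys} → Admissible (x ∷ ys) → All (NotShiftedSum x (B ys)) (seeds x ys)
  seeds-notShifted {ys = []}    adm = basicSeeds-notShifted adm
  seeds-notShifted {ys = _ ∷ _} adm = extra-notShifted adm ∷ basicSeeds-notShifted adm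

  distinctSums-correct : ∀ ys → Admissible ys →
                         All (SubsetSum (B ys)) (distinctSums ys) × Unique (distinctSums ys)
  distinctSums-correct []       adm = basicSeeds-sums [] , basicSeeds-unique adm
  distinctSums-correct (x ∷ ys) adm with distinctSums-correct ys (admissible-tail adm)
  ... | sums-ys , unique-ys =
    extend-sums x (B ys) sums-ys unique-ys (seeds-sums x ys) (seeds-unique adm) (seeds-notShifted adm)

  length-basicSeeds : ∀ ys → length (basicSeeds ys) ≡ 2 * length ys + 4
  length-basicSeeds ys = begin
    suc (length (B ys ++ map (_+ p) (ys ∷ʳ q)))
      ≡⟨ cong suc (length-++ (B ys)) ⟩
    suc (length (B ys) + length (map (_+ p) (ys ∷ʳ q)))
      ≡⟨ cong suc (cong₂ _+_ length-B (trans (length-map _ (ys ∷ʳ q)) length-∷ʳ)) ⟩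
    suc (length ys + 1 + 1 + (length ys + 1))
      ≡⟨ solve (length ys) ⟩
    2 * length ys + 4
      ∎
    where
    open ≡-Reasoning
    length-∷ʳ : ∀ {y} → length (ys ∷ʳ y) ≡ length ys + 1
    length-∷ʳ = length-++ ys
    length-B : length (B ys) ≡ length ys + 1 + 1
    length-B = trans (length-++ (ys ∷ʳ q)) (cong (_+ 1) length-∷ʳ)
    solve : ∀ k → suc (k + 1 + 1 + (k + 1)) ≡ 2 * k + 4
    solve = solve-∀

  length-distinctSums : ∀ ys → 0 < length ys →
                        suc (length (distinctSums ys)) ≡ (2 + length ys) * (2 + length ys)
  length-distinctSums (x ∷ [])     _ = refl
  length-distinctSums (x ∷ m ∷ ys) _ = begin
    suc (length (distinctSums (m ∷ ys) ++ map f (seeds x (m ∷ ys))))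
      ≡⟨ cong suc (length-++ (distinctSums (m ∷ ys))) ⟩
    suc (length (distinctSums (m ∷ ys))) + length (map f (seeds x (m ∷ ys)))
      ≡⟨ cong₂ _+_ (length-distinctSums (m ∷ ys) z<s)
                   (trans (length-map f (seeds x (m ∷ ys))) (cong suc (length-basicSeeds (m ∷ ys)))) ⟩
    (3 + k) * (3 + k) + suc (2 * suc k + 4)
      ≡⟨ solve k ⟩
    (4 + k) * (4 + k)
      ∎
    where
    open ≡-Reasoning
    k = length ys
    f = shiftedComplement x (B (m ∷ ys))
    solve : ∀ k → (3 + k) * (3 + k) + suc (2 * suc k + 4) ≡ (4 + k) * (4 + k)
    solve = solve-∀

distinct-subsetSums : ∀ xs → 3 ≤ length xs → AllPairs _<_ xs → All Odd xs →
  ∃ λ U → Unique U × All (SubsetSum xs) U × suc (length U) ≡ length xs * length xs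
distinct-subsetSums (p ∷ q ∷ zs) (s≤s (s≤s 1≤length-zs)) ascending odds =
  distinctSums ys , unique ,
  All.map (subsetSum-↭ (↭-reverse (p ∷ q ∷ zs)) ∘ subst (λ l → SubsetSum l _) B≡) sums ,
  trans (length-distinctSums ys (subst (0 <_) (sym length-ys) 1≤length-zs))
        (cong (λ n → (2 + n) * (2 + n)) length-ys)
  where
  open OddSubsetSums p q (All.head odds) (All.head (All.tail odds)) (All.head (AllPairs.head ascending))
  ys = reverse zs
  admissible : Admissible ys
  admissible = record
    { decreasing = subst (AllPairs _>_) (unfold-reverse q zs)
                         (AllPairs-reverse⁺ (AllPairs.tail ascending))
    ; odd        = All-reverse⁺ (All.tail (All.tail odds))
    }
  sums = proj₁ (distinctSums-correct ys admissible)
  unique = proj₂ (distinctSums-correct ys admissible)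
  B≡ : B ys ≡ reverse (p ∷ q ∷ zs)
  B≡ = sym (trans (unfold-reverse p (q ∷ zs)) (cong (_∷ʳ p) (unfold-reverse q zs)))
  length-ys : length ys ≡ length zs
  length-ys = length-reverse zs

-- The extremal example

oddsFrom : ℕ → (n : ℕ) → Vec ℕ n
oddsFrom c zero    = []
oddsFrom c (suc n) = suc (2 * c) ∷ oddsFrom (suc c) n

lookup-oddsFrom : ∀ c {n} (i : Fin n) → lookup (oddsFrom c n) i ≡ suc (2 * (c + toℕ i))
lookup-oddsFrom c zero    = cong (λ z → suc (2 * z)) (sym (+-identityʳ c))
lookup-oddsFrom c (suc i) =
  trans (lookup-oddsFrom (suc c) i) (cong (λ z → suc (2 * z)) (sym (+-suc c (toℕ i))))

oddsFrom-increasing : ∀ n → StrictlyIncreasing (oddsFrom 0 n)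
oddsFrom-increasing n i j i<j =
  subst₂ _<_ (sym (lookup-oddsFrom 0 i)) (sym (lookup-oddsFrom 0 j)) (s<s (*-monoʳ-< 2 i<j))

oddsFrom-oddPositive : ∀ n → OddPositive (oddsFrom 0 n)
oddsFrom-oddPositive n i =
  subst (λ v → 0 < v × Odd v) (sym (lookup-oddsFrom 0 i)) (z<s , toℕ i , refl)

sum-oddsFrom : ∀ c n → c * c + sum (toList (oddsFrom c n)) ≡ (c + n) * (c + n)
sum-oddsFrom c zero    = trans (+-identityʳ (c * c)) (cong (λ z → z * z) (sym (+-identityʳ c)))
sum-oddsFrom c (suc n) = begin
  c * c + (suc (2 * c) + rest)   ≡⟨ solve c rest ⟩
  suc c * suc c + rest           ≡⟨ sum-oddsFrom (suc c) n ⟩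
  (suc c + n) * (suc c + n)      ≡⟨ cong (λ z → z * z) (sym (+-suc c n)) ⟩
  (c + suc n) * (c + suc n)      ∎
  where
  open ≡-Reasoning
  rest = sum (toList (oddsFrom (suc c) n))
  solve : ∀ c r → c * c + (suc (2 * c) + r) ≡ suc c * suc c + r
  solve = solve-∀

oddsFrom-≥ : ∀ c n → All (suc (2 * c) ≤_) (toList (oddsFrom c n))
oddsFrom-≥ c zero    = []
oddsFrom-≥ c (suc n) =
  ≤-refl ∷ All.map (≤-trans (s≤s (*-monoʳ-≤ 2 (n≤1+n c)))) (oddsFrom-≥ (suc c) n)

subsetSum-0-or-≥ : ∀ {m xs u} → All (m ≤_) xs → SubsetSum xs u → u ≡ 0 ⊎ m ≤ u
subsetSum-0-or-≥ []           empty            = inj₁ refl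
subsetSum-0-or-≥ (_ ∷ m≤xs)   (skip s)         = subsetSum-0-or-≥ m≤xs s
subsetSum-0-or-≥ (m≤x ∷ _)    (pick {u = u} s) = inj₂ (≤-trans m≤x (m≤m+n _ u))

subsetSum≢2 : ∀ {xs u} → All (3 ≤_) xs → SubsetSum (1 ∷ xs) u → u ≢ 2
subsetSum≢2 3≤xs (skip s) refl with subsetSum-0-or-≥ 3≤xs s
... | inj₂ (s≤s (s≤s ()))
subsetSum≢2 3≤xs (pick s) refl with subsetSum-0-or-≥ 3≤xs s
... | inj₂ (s≤s ())

-- {0, 1, …, t + 5} without 2 and t + 3
gapped : ℕ → List ℕ
gapped t = 0 ∷ 1 ∷ map (3 +_) (upTo t) ++ 4 + t ∷ 5 + t ∷ []

length-gapped : ∀ t → length (gapped t) ≡ 4 + t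
length-gapped t = cong (2 +_) (begin
  length (map (3 +_) (upTo t) ++ 4 + t ∷ 5 + t ∷ []) ≡⟨ length-++ (map (3 +_) (upTo t)) ⟩
  length (map (3 +_) (upTo t)) + 2                  ≡⟨ cong (_+ 2) (length-map (3 +_) (upTo t)) ⟩
  length (upTo t) + 2                               ≡⟨ cong (_+ 2) (length-upTo t) ⟩
  t + 2                                             ≡⟨ +-comm t 2 ⟩
  2 + t                                             ∎)
  where open ≡-Reasoning

∈-gapped : ∀ t {u} → u ≤ 5 + t → u ≢ 2 → u ≢ 3 + t → u ∈ gapped t
∈-gapped t {0}                 _  _   _     = here refl
∈-gapped t {1}                 _  _   _     = there (here refl)
∈-gapped t {2}                 _  u≢2 _     = ⊥-elim (u≢2 refl)
∈-gapped t {suc (suc (suc w))} u≤ _   u≢3+t with <-cmp w t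
... | tri< w<t _ _ = there (there (∈-++⁺ˡ (∈-map⁺ (3 +_) (∈-upTo⁺ w<t))))
... | tri≈ _ refl _ = ⊥-elim (u≢3+t refl)
... | tri> _ _ t<w with m≤n⇒m<n∨m≡n (≤-pred (≤-pred (≤-pred u≤)))
...   | inj₂ refl     = there (there (∈-++⁺ʳ (map (3 +_) (upTo t)) (there (here refl))))
...   | inj₁ w<2+t rewrite ≤-antisym (≤-pred w<2+t) t<w =
  there (there (∈-++⁺ʳ (map (3 +_) (upTo t)) (here refl)))

-- Signed sums

open import Data.Integer using (+_)

-- S − 2u: the signed sum of a set with sum S whose elements in a subset with sum u get sign −1.
flipSum : ℕ → ℕ → ℤ
flipSum S u = + S ℤ.- + 2 ℤ.* + u

flipSum-injective : ∀ S {u v} → flipSum S u ≡ flipSum S v → u ≡ v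
flipSum-injective S {u} {v} eq = ℤ.+-injective (ℤ.*-cancelˡ-≡ (+ 2) (+ u) (+ v) (begin
  + 2 ℤ.* + u              ≡⟨ double-from-flip (+ S) (+ u) ⟩
  + S ℤ.- flipSum S u      ≡⟨ cong (λ T → + S ℤ.- T) eq ⟩
  + S ℤ.- flipSum S v      ≡⟨ double-from-flip (+ S) (+ v) ⟨
  + 2 ℤ.* + v              ∎))
  where
  open ≡-Reasoning
  double-from-flip : ∀ S U → + 2 ℤ.* U ≡ S ℤ.- (S ℤ.- + 2 ℤ.* U)
  double-from-flip = ℤ-Solver.solve-∀

flipSum-plus : ∀ x S u → ℤ.1ℤ ℤ.* + x ℤ.+ flipSum S u ≡ flipSum (x + S) u
flipSum-plus x S u =
  trans (identity (+ x) (+ S) (+ u)) (cong (λ T → T ℤ.- + 2 ℤ.* + u) (sym (ℤ.pos-+ x S)))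
  where
  identity : ∀ X S U → ℤ.1ℤ ℤ.* X ℤ.+ (S ℤ.- + 2 ℤ.* U) ≡ (X ℤ.+ S) ℤ.- + 2 ℤ.* U
  identity = ℤ-Solver.solve-∀

flipSum-minus : ∀ x S u → ℤ.-1ℤ ℤ.* + x ℤ.+ flipSum S u ≡ flipSum (x + S) (x + u)
flipSum-minus x S u =
  trans (identity (+ x) (+ S) (+ u)) (sym (cong₂ (λ T V → T ℤ.- + 2 ℤ.* V) (ℤ.pos-+ x S) (ℤ.pos-+ x u)))
  where
  identity : ∀ X S U → ℤ.-1ℤ ℤ.* X ℤ.+ (S ℤ.- + 2 ℤ.* U) ≡ (X ℤ.+ S) ℤ.- + 2 ℤ.* (X ℤ.+ U)
  identity = ℤ-Solver.solve-∀

∈-allCoeffVecs⁺ : ∀ {k c} {cs : Vec ℤ k} →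
                  c ∈ coeffs → cs ∈ allCoeffVecs k → c ∷ cs ∈ allCoeffVecs (suc k)
∈-allCoeffVecs⁺ {k} c∈ cs∈ =
  ∈-concatMap⁺ (λ c → map (c ∷_) (allCoeffVecs k)) (Any.map (λ { refl → ∈-map⁺ _ cs∈ }) c∈)

∈-allCoeffVecs⁻ : ∀ {k c} {cs : Vec ℤ k} →
                  c ∷ cs ∈ allCoeffVecs (suc k) → c ∈ coeffs × cs ∈ allCoeffVecs k
∈-allCoeffVecs⁻ {k} c∷cs∈ =
  Any.map (proj₁ ∘ ∈-cons-map⁻) ∈-some , proj₂ (∈-cons-map⁻ (proj₂ (Any.satisfied ∈-some)))
  where
  ∈-some = ∈-concatMap⁻ (λ c → map (c ∷_) (allCoeffVecs k)) {xs = coeffs} c∷cs∈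
  ∈-cons-map⁻ : ∀ {c c′} {cs : Vec ℤ k} →
                c ∷ cs ∈ map (c′ ∷_) (allCoeffVecs k) → c ≡ c′ × cs ∈ allCoeffVecs k
  ∈-cons-map⁻ m with ∈-map⁻ _ m
  ... | _ , cs∈ , refl = refl , cs∈

weight-≤ : ∀ {k} {cs : Vec ℤ k} → cs ∈ allCoeffVecs k → weight cs ≤ k
weight-≤ {cs = []} _ = z≤n
weight-≤ {cs = c ∷ cs} c∷cs∈ with ∈-allCoeffVecs⁻ c∷cs∈
... | here refl                 , cs∈ = s≤s (weight-≤ cs∈)
... | there (here refl)         , cs∈ = m≤n⇒m≤1+n (weight-≤ cs∈)
... | there (there (here refl)) , cs∈ = s≤s (weight-≤ cs∈)

subsetSum⇒signVector : ∀ {k} (a : Vec ℕ k) {u} → SubsetSum (toList a) u →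
  ∃ λ cs → cs ∈ allCoeffVecs k × weight cs ≡ k × dot cs (toℤ a) ≡ flipSum (sum (toList a)) u
subsetSum⇒signVector [] empty = [] , here refl , refl , refl
subsetSum⇒signVector (x ∷ a) (skip {u = u} s) with subsetSum⇒signVector a s
... | cs , cs∈ , w , eq =
  ℤ.1ℤ ∷ cs , ∈-allCoeffVecs⁺ (there (there (here refl))) cs∈ , cong suc w ,
  trans (cong (λ D → ℤ.1ℤ ℤ.* + x ℤ.+ D) eq) (flipSum-plus x (sum (toList a)) u)
subsetSum⇒signVector (x ∷ a) (pick {u = u} s) with subsetSum⇒signVector a s
... | cs , cs∈ , w , eq =
  ℤ.-1ℤ ∷ cs , ∈-allCoeffVecs⁺ (here refl) cs∈ , cong suc w ,
  trans (cong (λ D → ℤ.-1ℤ ℤ.* + x ℤ.+ D) eq) (flipSum-minus x (sum (toList a)) u)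

signVector⇒subsetSum : ∀ {k} (a : Vec ℕ k) {cs} → cs ∈ allCoeffVecs k → weight cs ≡ k →
  ∃ λ u → SubsetSum (toList a) u × dot cs (toℤ a) ≡ flipSum (sum (toList a)) u
signVector⇒subsetSum [] {[]} _ _ = 0 , empty , refl
signVector⇒subsetSum (x ∷ a) {c ∷ cs} c∷cs∈ w with ∈-allCoeffVecs⁻ c∷cs∈
... | here refl , cs∈ with signVector⇒subsetSum a cs∈ (suc-injective w)
...   | u , s , eq =
  x + u , pick s , trans (cong (λ D → ℤ.-1ℤ ℤ.* + x ℤ.+ D) eq) (flipSum-minus x (sum (toList a)) u)
signVector⇒subsetSum (x ∷ a) {c ∷ cs} c∷cs∈ w | there (here refl) , cs∈ =
  ⊥-elim (<-irrefl w (s≤s (weight-≤ cs∈)))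
signVector⇒subsetSum (x ∷ a) {c ∷ cs} c∷cs∈ w | there (there (here refl)) , cs∈
  with signVector⇒subsetSum a cs∈ (suc-injective w)
... | u , s , eq =
  u , skip s , trans (cong (λ D → ℤ.1ℤ ℤ.* + x ℤ.+ D) eq) (flipSum-plus x (sum (toList a)) u)

module _ {k} (a : Vec ℕ k) where

  private
    S = sum (toList a)

  ∈-signedSumList⁺ : ∀ {u} → SubsetSum (toList a) u → flipSum S u ∈ signedSumList k (toℤ a)
  ∈-signedSumList⁺ s with subsetSum⇒signVector a s
  ... | cs , cs∈ , w , eq =
    ∈-map∘filter⁺ (λ cs → dot cs (toℤ a)) (λ cs → weight cs ≟ k) (cs , cs∈ , sym eq , w)

  ∈-signedSumList⁻ : ∀ {z} → z ∈ signedSumList k (toℤ a) →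
                     ∃ λ u → SubsetSum (toList a) u × z ≡ flipSum S u
  ∈-signedSumList⁻ z∈ with ∈-map∘filter⁻ (λ cs → dot cs (toℤ a)) (λ cs → weight cs ≟ k) z∈
  ... | cs , cs∈ , refl , w with signVector⇒subsetSum a cs∈ w
  ...   | u , s , eq = u , s , eq

  size-≥ : ∀ {U} → Unique U → All (SubsetSum (toList a)) U →
           length U ≤ restrictedSignedSumsetSize k (toℤ a)
  size-≥ {U} uniq sums = subst (_≤ _) (length-map (flipSum S) U)
    (Unique-⊆⇒length-≤ (Unique.map⁺ (flipSum-injective S) uniq) flipped⊆)
    where
    flipped⊆ : map (flipSum S) U ⊆ deduplicate ℤ._≟_ (signedSumList k (toℤ a))
    flipped⊆ z∈ with ∈-map⁻ (flipSum S) z∈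
    ... | u , u∈U , refl = ∈-deduplicate⁺ ℤ._≟_ (∈-signedSumList⁺ (All.lookup sums u∈U))

  size-≤ : ∀ {T} → (∀ {u} → SubsetSum (toList a) u → u ∈ T) →
           restrictedSignedSumsetSize k (toℤ a) ≤ length T
  size-≤ {T} ⊆T = subst (_ ≤_) (length-map (flipSum S) T)
    (Unique-⊆⇒length-≤ (deduplicate-! (signedSumList k (toℤ a))) ⊆flipped)
    where
    ⊆flipped : deduplicate ℤ._≟_ (signedSumList k (toℤ a)) ⊆ map (flipSum S) T
    ⊆flipped z∈ with ∈-signedSumList⁻ (∈-deduplicate⁻ ℤ._≟_ (signedSumList k (toℤ a)) z∈)
    ... | u , s , refl = ∈-map⁺ (flipSum S) (⊆T s)

oddsFrom-size-≤ : ∀ h → 3 ≤ h → restrictedSignedSumsetSize h (toℤ (oddsFrom 0 h)) ≤ h * h ∸ 1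
oddsFrom-size-≤ h (s≤s (s≤s (s≤s {n = k} _))) =
  subst (restrictedSignedSumsetSize h (toℤ a) ≤_) length≡ (size-≤ a ∈gapped)
  where
  a = oddsFrom 0 h
  t = 4 + 6 * k + k * k
  square : h * h ≡ 5 + t
  square = solve k
    where
    solve : ∀ k → (3 + k) * (3 + k) ≡ 5 + (4 + 6 * k + k * k)
    solve = solve-∀
  sum≡ : sum (toList a) ≡ 5 + t
  sum≡ = trans (sum-oddsFrom 0 h) square
  length≡ : length (gapped t) ≡ h * h ∸ 1
  length≡ = trans (length-gapped t) (cong (_∸ 1) (sym square))
  3≤ : All (3 ≤_) (toList (oddsFrom 1 (2 + k)))
  3≤ = oddsFrom-≥ 1 (2 + k)
  complement≡2 : ∀ {u} → u ≡ 3 + t → sum (toList a) ∸ u ≡ 2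
  complement≡2 refl = trans (cong (_∸ (3 + t)) sum≡) (m+n∸n≡m 2 (3 + t))
  ∈gapped : ∀ {u} → SubsetSum (toList a) u → u ∈ gapped t
  ∈gapped {u} s = ∈-gapped t (subst (u ≤_) sum≡ (subsetSum-≤ s)) (subsetSum≢2 3≤ s)
    (λ u≡3+t → subsetSum≢2 3≤ (subsetSum-complement s) (complement≡2 u≡3+t))

StrictlyIncreasing⇒AllPairs : ∀ {k} (a : Vec ℕ k) → StrictlyIncreasing a → AllPairs _<_ (toList a)
StrictlyIncreasing⇒AllPairs []      _          = []
StrictlyIncreasing⇒AllPairs (x ∷ a) increasing =
  VecAll.toList⁺ (VecAll.lookup⁻ (λ i → increasing zero (suc i) z<s))
  ∷ StrictlyIncreasing⇒AllPairs a (λ i j i<j → increasing (suc i) (suc j) (s<s i<j))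

OddPositive⇒All-Odd : ∀ {k} (a : Vec ℕ k) → OddPositive a → All Odd (toList a)
OddPositive⇒All-Odd a oddPositive =
  All.map proj₂ (VecAll.toList⁺ (VecAll.lookup⁻ {P = λ v → 0 < v × Odd v} oddPositive))

lower-bound : ∀ h → 3 ≤ h → (a : Vec ℕ h) → StrictlyIncreasing a → OddPositive a →
              h * h ∸ 1 ≤ restrictedSignedSumsetSize h (toℤ a)
lower-bound h 3≤h a increasing oddPositive
  with distinct-subsetSums (toList a) (subst (3 ≤_) (sym (length-toList a)) 3≤h)
         (StrictlyIncreasing⇒AllPairs a increasing) (OddPositive⇒All-Odd a oddPositive)
... | U , unique , sums , count =
  subst (_≤ restrictedSignedSumsetSize h (toℤ a))
    (trans (cong (_∸ 1) count) (cong (λ n → n * n ∸ 1) (length-toList a))) (size-≥ a unique sums)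

lemma2 : ((h : ℕ) → 3 ≤ h → (a : Vec ℕ h) → StrictlyIncreasing a → OddPositive a →
           h * h ∸ 1 ≤ restrictedSignedSumsetSize h (toℤ a))
         × ((h : ℕ) → 3 ≤ h → ∃ λ (a : Vec ℕ h) → StrictlyIncreasing a × OddPositive a ×
           restrictedSignedSumsetSize h (toℤ a) ≡ h * h ∸ 1)
lemma2 = lower-bound , λ h 3≤h →
  oddsFrom 0 h , oddsFrom-increasing h , oddsFrom-oddPositive h ,
  ≤-antisym (oddsFrom-size-≤ h 3≤h)
            (lower-bound h 3≤h (oddsFrom 0 h) (oddsFrom-increasing h) (oddsFrom-oddPositive h))
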